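{- As formal power series in $z$, $$\sum_{n\ge0}Q^{(a)}_n(t)z^n=\mathfrak{J}\big((2h+a)t,\;h(h-1+a)(1+t^2)\big),$$ i.e. the Jacobi continued fraction with $b_h=(2h+a)t$ for $h\ge0$ and $\lambda_h=h(h-1+a)(1+t^2)$ for $h\ge1$.
   Context: $Q^{(a)}_n(t)$ are the polynomials in $a$ and $t$ with exponential generating function $\sum_{n\ge0}Q^{(a)}_n(t)z^n/n!=(\cos z-t\sin z)^{ -a}$ (equivalently $Q^{(a)}_0=1$, $Q^{(a)}_{n+1}=(1+t^2)\frac{d}{dt}Q^{(a)}_n+atQ^{(a)}_n$). For sequences $(b_h)_{h\ge0}$, $(\lambda_h)_{h\ge1}$, $\mathfrak{J}(b_h,\lambda_h)$ denotes the continued fraction $1/(1-b_0z-\lambda_1z^2/(1-b_1z-\lambda_2z^2/(\cdots)))$. -}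

module Defs where

open import Data.Nat using (ℕ; zero; suc; _+_; _*_; _∸_)

sumTo : ℕ → (ℕ → ℕ) → ℕ
sumTo zero    f = f zero
sumTo (suc n) f = sumTo n f + f (suc n)

-- Polynomials in the two indeterminates a and t, given by their
-- coefficient arrays:  p i j  = coefficient of a^i t^j.
-- (All polynomials occurring here have nonnegative integer coefficients.)

Poly : Set
Poly = ℕ → ℕ → ℕ

0ₚ : Poly
0ₚ _ _ = 0

1ₚ : Poly
1ₚ zero zero = 1
1ₚ _    _    = 0

aₚ : Poly
aₚ (suc zero) zero = 1
aₚ _          _    = 0

tₚ : Poly
tₚ zero (suc zero) = 1
tₚ _    _          = 0

constₚ : ℕ → Poly
constₚ c zero zero = c
constₚ c _    _    = 0

infixl 6 _+ₚ_
infixl 7 _*ₚ_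

_+ₚ_ : Poly → Poly → Poly
(p +ₚ q) i j = p i j + q i j

_*ₚ_ : Poly → Poly → Poly
(p *ₚ q) i j = sumTo i (λ k → sumTo j (λ l → p k l * q (i ∸ k) (j ∸ l)))

∂ₜ : Poly → Poly
∂ₜ p i j = suc j * p i (suc j)

1+t² : Poly
1+t² = 1ₚ +ₚ tₚ *ₚ tₚ

Q : ℕ → Poly
Q zero    = 1ₚ
Q (suc n) = 1+t² *ₚ ∂ₜ (Q n) +ₚ aₚ *ₚ tₚ *ₚ Q n

-- Formal power series in z with coefficients in ℕ[a,t]:
-- F n = coefficient of z^n.

Series : Set
Series = ℕ → Poly

sumPoly : ℕ → (ℕ → Poly) → Poly
sumPoly n f i j = sumTo n (λ k → f k i j)

1ₛ : Series
1ₛ zero    = 1ₚ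
1ₛ (suc _) = 0ₚ

_*ₛ_ : Series → Series → Series
(F *ₛ G) n = sumPoly n (λ k → F k *ₚ G (n ∸ k))

_^ₛ_ : Series → ℕ → Series
F ^ₛ zero  = 1ₛ
F ^ₛ suc k = F *ₛ (F ^ₛ k)

z*_ : Series → Series
(z* U) zero    = 0ₚ
(z* U) (suc n) = U n

-- 1 / (1 - z·U) = Σ_k (z U)^k ; the coefficient of z^n only involves k ≤ n
inv1-z* : Series → Series
inv1-z* U n = sumPoly n (λ k → ((z* U) ^ₛ k) n)

-- Jacobi continued fractions
--   J(b_h, λ_h) = 1/(1 - b_0 z - λ_1 z²/(1 - b_1 z - λ_2 z²/(...)))
-- The convergent of depth N (levels 0..N, tail below level N dropped):
--   frac b λ 0       h = 1/(1 - b_h z)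
--   frac b λ (suc d) h = 1/(1 - z (b_h + λ_{h+1} z · frac b λ d (h+1)))

frac : (b : ℕ → Poly) (λ' : ℕ → Poly) → ℕ → ℕ → Series
frac b λ' zero    h = inv1-z* U
  where
  U : Series
  U zero    = b h
  U (suc _) = 0ₚ
frac b λ' (suc d) h = inv1-z* U
  where
  U : Series
  U zero    = b h
  U (suc n) = λ' (suc h) *ₚ frac b λ' d (suc h) n

Jconv : (b : ℕ → Poly) (λ' : ℕ → Poly) → ℕ → Series
Jconv b λ' N = frac b λ' N 0

-- The specific coefficients
--   b_h = (2h + a) t          (h ≥ 0)
--   λ_h = h (h - 1 + a)(1+t²) (h ≥ 1; the value at h = 0 is never used)

bQ : ℕ → Poly
bQ h = (constₚ (2 * h) +ₚ aₚ) *ₚ tₚ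

λQ : ℕ → Poly
λQ h = constₚ h *ₚ (constₚ (h ∸ 1) +ₚ aₚ) *ₚ 1+t²

-- Expanding 1/(1 − zU) as Σₖ (zU)ᵏ level by level, the z^n coefficient of the
-- depth-N convergent of J(b_h, λ_h) is, for n ≤ N, the total weight of Motzkin
-- paths of length n from height 0 to height 0 in which a level step at height h
-- weighs b_h and a down step from height h weighs λ_h (Flajolet).  Write
-- P_{n,k} for the weight of such paths ending at height k, so that
-- P_{n+1,k} = P_{n,k−1} + b_k P_{n,k} + λ_{k+1} P_{n,k+1}.
-- Let T_{n,k} = ∂ᵏQ_n / (k! (a)_k), where (a)_k is the rising factorial.  Then
-- ∂T_{n,k} = (k+1)(k+a) T_{n,k+1}, and differentiating
-- Q_{n+1} = (1+t²)Q_n' + atQ_n k times gives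
-- T_{n+1,k} = T_{n,k−1} + (2k+a)t T_{n,k} + (1+t²) ∂T_{n,k}.  Since
-- λ_{k+1} = (k+1)(k+a)(1+t²), the last term is λ_{k+1} T_{n,k+1}; so T obeys
-- the recurrence of P, and Q_n = T_{n,0} = P_{n,0}.

module Submission where

open import Defs
open import Data.Nat as ℕ using (ℕ; zero; suc; _∸_; _≤_; _<_; z≤n; s≤s; _≤′_; ≤′-refl; ≤′-step; _≤ᵇ_)
import Data.Nat.Properties as ℕₚ
open import Data.Nat.Induction using (<-rec)
open import Data.Bool using (true; if_then_else_)
open import Data.Product using (_,_)
open import Algebra.Bundles using (CommutativeSemiring)
open import Algebra.Core using (Op₂)
open import Algebra.Structures.Biased using (isCommutativeSemiringˡ)
open import Relation.Binary.PropositionalEquality as ≡ using (_≡_)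
import Relation.Binary.Reasoning.Setoid as SetoidReasoning

module FiniteSum {c ℓ} (R : CommutativeSemiring c ℓ) where
  open CommutativeSemiring R hiding (zero)
  open import Algebra.Properties.CommutativeSemigroup +-commutativeSemigroup using (interchange)
  open SetoidReasoning setoid

  ∑ : ℕ → (ℕ → Carrier) → Carrier
  ∑ zero    f = f zero
  ∑ (suc n) f = ∑ n f + f (suc n)

  ∑-cong-≤ : ∀ n {f g} → (∀ k → k ≤ n → f k ≈ g k) → ∑ n f ≈ ∑ n g
  ∑-cong-≤ zero    f≈g = f≈g 0 z≤n
  ∑-cong-≤ (suc n) f≈g =
    +-cong (∑-cong-≤ n (λ k k≤n → f≈g k (ℕₚ.m≤n⇒m≤1+n k≤n))) (f≈g (suc n) ℕₚ.≤-refl)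

  ∑-cong : ∀ n {f g} → (∀ k → f k ≈ g k) → ∑ n f ≈ ∑ n g
  ∑-cong n f≈g = ∑-cong-≤ n (λ k _ → f≈g k)

  ∑-zero : ∀ n {f} → (∀ k → k ≤ n → f k ≈ 0#) → ∑ n f ≈ 0#
  ∑-zero zero    f≈0 = f≈0 0 z≤n
  ∑-zero (suc n) f≈0 =
    trans (+-cong (∑-zero n (λ k k≤n → f≈0 k (ℕₚ.m≤n⇒m≤1+n k≤n))) (f≈0 (suc n) ℕₚ.≤-refl))
          (+-identityˡ 0#)

  ∑-distrib-+ : ∀ n (f g : ℕ → Carrier) → ∑ n (λ k → f k + g k) ≈ ∑ n f + ∑ n g
  ∑-distrib-+ zero    f g = refl
  ∑-distrib-+ (suc n) f g = trans (+-congʳ (∑-distrib-+ n f g)) (interchange _ _ _ _)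

  ∑-distribˡ : ∀ n x (f : ℕ → Carrier) → x * ∑ n f ≈ ∑ n (λ k → x * f k)
  ∑-distribˡ zero    x f = refl
  ∑-distribˡ (suc n) x f = trans (distribˡ _ _ _) (+-congʳ (∑-distribˡ n x f))

  ∑-distribʳ : ∀ n x (f : ℕ → Carrier) → ∑ n f * x ≈ ∑ n (λ k → f k * x)
  ∑-distribʳ n x f = trans (*-comm _ _) (trans (∑-distribˡ n x f) (∑-cong n (λ k → *-comm _ _)))

  ∑-front : ∀ n (f : ℕ → Carrier) → ∑ (suc n) f ≈ f 0 + ∑ n (λ k → f (suc k))
  ∑-front zero    f = refl
  ∑-front (suc n) f = trans (+-congʳ (∑-front n f)) (+-assoc _ _ _)

  ∑-swap : ∀ n m (F : ℕ → ℕ → Carrier) →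
           ∑ n (λ i → ∑ m (λ j → F i j)) ≈ ∑ m (λ j → ∑ n (λ i → F i j))
  ∑-swap zero    m F = refl
  ∑-swap (suc n) m F = trans (+-congʳ (∑-swap n m F)) (sym (∑-distrib-+ m _ _))

  ∑-reverse : ∀ n (f : ℕ → Carrier) → ∑ n f ≈ ∑ n (λ k → f (n ∸ k))
  ∑-reverse zero    f = refl
  ∑-reverse (suc n) f = begin
    ∑ n f + f (suc n)                   ≈⟨ +-comm _ _ ⟩
    f (suc n) + ∑ n f                   ≈⟨ +-congˡ (∑-reverse n f) ⟩
    f (suc n) + ∑ n (λ k → f (n ∸ k))   ≈⟨ ∑-front n (λ k → f (suc n ∸ k)) ⟨
    ∑ (suc n) (λ k → f (suc n ∸ k))     ∎

  ∑-extend : ∀ {m n} (f : ℕ → Carrier) → m ≤ n → (∀ k → m < k → f k ≈ 0#) → ∑ n f ≈ ∑ m f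
  ∑-extend {m} f m≤n f≈0 = go (ℕₚ.≤⇒≤′ m≤n)
    where
    go : ∀ {n} → m ≤′ n → ∑ n f ≈ ∑ m f
    go ≤′-refl = refl
    go (≤′-step {n} m≤′n) =
      trans (+-cong (go m≤′n) (f≈0 (suc n) (s≤s (ℕₚ.≤′⇒≤ m≤′n)))) (+-identityʳ _)

  ∑-triangle : ∀ n (F : ℕ → ℕ → Carrier) →
               ∑ n (λ k → ∑ k (λ i → F i k)) ≈ ∑ n (λ i → ∑ (n ∸ i) (λ j → F i (i ℕ.+ j)))
  ∑-triangle zero    F = refl
  ∑-triangle (suc n) F = begin
    ∑ n (λ k → ∑ k (λ i → F i k)) + (∑ n (λ i → F i (suc n)) + F (suc n) (suc n))
      ≈⟨ +-congʳ (∑-triangle n F) ⟩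
    ∑ n (λ i → ∑ (n ∸ i) (λ j → F i (i ℕ.+ j))) + (∑ n (λ i → F i (suc n)) + F (suc n) (suc n))
      ≈⟨ +-assoc _ _ _ ⟨
    (∑ n (λ i → ∑ (n ∸ i) (λ j → F i (i ℕ.+ j))) + ∑ n (λ i → F i (suc n))) + F (suc n) (suc n)
      ≈⟨ +-cong (trans (sym (∑-distrib-+ n _ _)) (∑-cong-≤ n extendRow))
                (reflexive (≡.cong (F (suc n)) (≡.sym (ℕₚ.+-identityʳ (suc n))))) ⟩
    ∑ n (λ i → ∑ (suc n ∸ i) (λ j → F i (i ℕ.+ j))) + F (suc n) (suc n ℕ.+ 0)
      ≡⟨ ≡.cong (λ m → ∑ n (λ i → ∑ (suc n ∸ i) (λ j → F i (i ℕ.+ j))) + ∑ m (λ j → F (suc n) (suc n ℕ.+ j)))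
                (ℕₚ.n∸n≡0 n) ⟨
    ∑ n (λ i → ∑ (suc n ∸ i) (λ j → F i (i ℕ.+ j))) + ∑ (n ∸ n) (λ j → F (suc n) (suc n ℕ.+ j)) ∎
    where
    extendRow : ∀ i → i ≤ n →
      ∑ (n ∸ i) (λ j → F i (i ℕ.+ j)) + F i (suc n) ≈ ∑ (suc n ∸ i) (λ j → F i (i ℕ.+ j))
    extendRow i i≤n rewrite ℕₚ.+-∸-assoc 1 i≤n =
      +-congˡ (reflexive (≡.cong (F i) (≡.sym (≡.trans (ℕₚ.+-suc i (n ∸ i)) (≡.cong suc (ℕₚ.m+[n∸m]≡n i≤n))))))

  ∑-convolution-comm : ∀ n (f g : ℕ → Carrier) →
                       ∑ n (λ k → f k * g (n ∸ k)) ≈ ∑ n (λ k → g k * f (n ∸ k))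
  ∑-convolution-comm n f g = trans (∑-reverse n _) (∑-cong-≤ n (λ k k≤n →
    trans (*-comm _ _) (*-congʳ (reflexive (≡.cong g (ℕₚ.m∸[m∸n]≡n k≤n))))))

module CauchyProduct {c ℓ} (R : CommutativeSemiring c ℓ) where
  open CommutativeSemiring R hiding (zero)
  open FiniteSum R
  open SetoidReasoning setoid
  open import Relation.Binary.Structures using (IsEquivalence)

  _≋_ : (ℕ → Carrier) → (ℕ → Carrier) → Set ℓ
  f ≋ g = ∀ n → f n ≈ g n

  _⊕_ : Op₂ (ℕ → Carrier)
  (f ⊕ g) n = f n + g n

  _⊛_ : Op₂ (ℕ → Carrier)
  (f ⊛ g) n = ∑ n (λ k → f k * g (n ∸ k))

  𝟘 : ℕ → Carrier
  𝟘 _ = 0#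

  𝟙 : ℕ → Carrier
  𝟙 zero    = 1#
  𝟙 (suc _) = 0#

  ≋-isEquivalence : IsEquivalence _≋_
  ≋-isEquivalence = record
    { refl = λ n → refl ; sym = λ f≋g n → sym (f≋g n) ; trans = λ f≋g g≋h n → trans (f≋g n) (g≋h n) }

  ⊛-cong : ∀ {f f′ g g′} → f ≋ f′ → g ≋ g′ → (f ⊛ g) ≋ (f′ ⊛ g′)
  ⊛-cong f≋f′ g≋g′ n = ∑-cong n (λ k → *-cong (f≋f′ k) (g≋g′ (n ∸ k)))

  ⊛-assoc : ∀ f g h → ((f ⊛ g) ⊛ h) ≋ (f ⊛ (g ⊛ h))
  ⊛-assoc f g h n = begin
    ∑ n (λ k → ∑ k (λ i → f i * g (k ∸ i)) * h (n ∸ k))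
      ≈⟨ ∑-cong n (λ k → ∑-distribʳ k (h (n ∸ k)) (λ i → f i * g (k ∸ i))) ⟩
    ∑ n (λ k → ∑ k (λ i → (f i * g (k ∸ i)) * h (n ∸ k)))
      ≈⟨ ∑-triangle n (λ i k → (f i * g (k ∸ i)) * h (n ∸ k)) ⟩
    ∑ n (λ i → ∑ (n ∸ i) (λ j → (f i * g ((i ℕ.+ j) ∸ i)) * h (n ∸ (i ℕ.+ j))))
      ≈⟨ ∑-cong n (λ i → ∑-cong (n ∸ i) (λ j →
           trans (*-cong (*-congˡ (reflexive (≡.cong g (ℕₚ.m+n∸m≡n i j))))
                         (reflexive (≡.cong h (≡.sym (ℕₚ.∸-+-assoc n i j)))))
                 (*-assoc _ _ _))) ⟩
    ∑ n (λ i → ∑ (n ∸ i) (λ j → f i * (g j * h ((n ∸ i) ∸ j))))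
      ≈⟨ ∑-cong n (λ i → ∑-distribˡ (n ∸ i) (f i) _) ⟨
    ∑ n (λ i → f i * ∑ (n ∸ i) (λ j → g j * h ((n ∸ i) ∸ j))) ∎

  ⊛-comm : ∀ f g → (f ⊛ g) ≋ (g ⊛ f)
  ⊛-comm f g n = ∑-convolution-comm n f g

  ⊛-identityˡ : ∀ f → (𝟙 ⊛ f) ≋ f
  ⊛-identityˡ f zero    = *-identityˡ _
  ⊛-identityˡ f (suc n) = begin
    ∑ (suc n) (λ k → 𝟙 k * f (suc n ∸ k))         ≈⟨ ∑-front n _ ⟩
    1# * f (suc n) + ∑ n (λ k → 0# * f (n ∸ k))   ≈⟨ +-cong (*-identityˡ _) (∑-zero n (λ k _ → zeroˡ _)) ⟩
    f (suc n) + 0#                                ≈⟨ +-identityʳ _ ⟩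
    f (suc n)                                     ∎

  cauchySemiring : CommutativeSemiring c ℓ
  cauchySemiring = record
    { Carrier = ℕ → Carrier ; _≈_ = _≋_ ; _+_ = _⊕_ ; _*_ = _⊛_ ; 0# = 𝟘 ; 1# = 𝟙
    ; isCommutativeSemiring = isCommutativeSemiringˡ (record
      { +-isCommutativeMonoid = record
        { isMonoid = record
          { isSemigroup = record
            { isMagma = record { isEquivalence = ≋-isEquivalence ; ∙-cong = λ f≋f′ g≋g′ n → +-cong (f≋f′ n) (g≋g′ n) }
            ; assoc = λ f g h n → +-assoc _ _ _ }
          ; identity = (λ f n → +-identityˡ _) , (λ f n → +-identityʳ _) }
        ; comm = λ f g n → +-comm _ _ }
      ; *-isCommutativeMonoid = record
        { isMonoid = record
          { isSemigroup = record
            { isMagma = record { isEquivalence = ≋-isEquivalence ; ∙-cong = ⊛-cong }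
            ; assoc = ⊛-assoc }
          ; identity = ⊛-identityˡ , (λ f n → trans (⊛-comm f 𝟙 n) (⊛-identityˡ f n)) }
        ; comm = ⊛-comm }
      ; distribʳ = λ f g h n → trans (∑-cong n (λ k → distribʳ _ _ _)) (∑-distrib-+ n _ _)
      ; zeroˡ = λ f n → ∑-zero n (λ k _ → zeroˡ _) })
    }

module _ {c ℓ} (R : CommutativeSemiring c ℓ) where
  open CommutativeSemiring R
  open import Algebra.Definitions _≈_

  private
    module Agreeing (_∙′_ _∙_ : Op₂ Carrier) (agree : ∀ x y → (x ∙′ y) ≈ (x ∙ y)) where
      open SetoidReasoning setoid

      cong′ : Congruent₂ _∙_ → Congruent₂ _∙′_
      cong′ ∙-cong {x} {x′} {y} {y′} x≈x′ y≈y′ =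
        trans (agree x y) (trans (∙-cong x≈x′ y≈y′) (sym (agree x′ y′)))

      assoc′ : Congruent₂ _∙_ → Associative _∙_ → Associative _∙′_
      assoc′ ∙-cong ∙-assoc x y z = begin
        (x ∙′ y) ∙′ z  ≈⟨ trans (agree _ _) (∙-cong (agree x y) refl) ⟩
        (x ∙ y) ∙ z    ≈⟨ ∙-assoc x y z ⟩
        x ∙ (y ∙ z)    ≈⟨ trans (agree _ _) (∙-cong refl (agree y z)) ⟨
        x ∙′ (y ∙′ z)  ∎

      comm′ : Commutative _∙_ → Commutative _∙′_
      comm′ ∙-comm x y = trans (agree x y) (trans (∙-comm x y) (sym (agree y x)))

      identity′ : Congruent₂ _∙_ → ∀ {e e′} → e′ ≈ e → Identity e _∙_ → Identity e′ _∙′_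
      identity′ ∙-cong e′≈e (idˡ , idʳ) =
        (λ x → trans (agree _ x) (trans (∙-cong e′≈e refl) (idˡ x))) ,
        (λ x → trans (agree x _) (trans (∙-cong refl e′≈e) (idʳ x)))

  replaceOperations : (_+′_ _*′_ : Op₂ Carrier) (0′ 1′ : Carrier) →
    (∀ x y → (x +′ y) ≈ (x + y)) → (∀ x y → (x *′ y) ≈ (x * y)) → 0′ ≈ 0# → 1′ ≈ 1# →
    CommutativeSemiring c ℓ
  replaceOperations _+′_ _*′_ 0′ 1′ +≈ *≈ 0≈ 1≈ = record
    { Carrier = Carrier ; _≈_ = _≈_ ; _+_ = _+′_ ; _*_ = _*′_ ; 0# = 0′ ; 1# = 1′
    ; isCommutativeSemiring = isCommutativeSemiringˡ (record
      { +-isCommutativeMonoid = record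
        { isMonoid = record
          { isSemigroup = record
            { isMagma = record { isEquivalence = isEquivalence ; ∙-cong = +′.cong′ +-cong }
            ; assoc = +′.assoc′ +-cong +-assoc }
          ; identity = +′.identity′ +-cong 0≈ +-identity }
        ; comm = +′.comm′ +-comm }
      ; *-isCommutativeMonoid = record
        { isMonoid = record
          { isSemigroup = record
            { isMagma = record { isEquivalence = isEquivalence ; ∙-cong = *′.cong′ *-cong }
            ; assoc = *′.assoc′ *-cong *-assoc }
          ; identity = *′.identity′ *-cong 1≈ *-identity }
        ; comm = *′.comm′ *-comm }
      ; distribʳ = λ x y z →
          trans (*≈ _ x) (trans (*-cong (+≈ y z) refl) (trans (distribʳ x y z)
            (sym (trans (+≈ _ _) (+-cong (*≈ y x) (*≈ z x))))))
      ; zeroˡ = λ x → trans (*≈ 0′ x) (trans (*-cong 0≈ refl) (trans (zeroˡ x) (sym 0≈))) })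
    }
    where
    module +′ = Agreeing _+′_ _+_ +≈
    module *′ = Agreeing _*′_ _*_ *≈

module MotzkinPaths {c ℓ} (R : CommutativeSemiring c ℓ) where
  open CommutativeSemiring R hiding (zero)
  open FiniteSum R
  open SetoidReasoning setoid
  open import Algebra.Solver.Ring.NaturalCoefficients.Default R

  fromBelow : (ℕ → Carrier) → ℕ → Carrier
  fromBelow f zero    = 0#
  fromBelow f (suc k) = f k

  fromBelow-cong : ∀ {f g} → (∀ k → f k ≈ g k) → ∀ k → fromBelow f k ≈ fromBelow g k
  fromBelow-cong f≈g zero    = refl
  fromBelow-cong f≈g (suc k) = f≈g k

  -- paths b λ′ n k is the total weight of the Motzkin paths of length n from
  -- height 0 to height k, where a level step at height h weighs b h and a down
  -- step from height h weighs λ′ h.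
  paths : (b λ′ : ℕ → Carrier) → ℕ → ℕ → Carrier
  paths b λ′ zero    zero    = 1#
  paths b λ′ zero    (suc k) = 0#
  paths b λ′ (suc n) k       =
    fromBelow (paths b λ′ n) k + b k * paths b λ′ n k + λ′ (suc k) * paths b λ′ n (suc k)

  paths-cong : ∀ {b b′ λ′ λ″} → (∀ j → b j ≈ b′ j) → (∀ j → λ′ j ≈ λ″ j) →
               ∀ n k → paths b λ′ n k ≈ paths b′ λ″ n k
  paths-cong b≈ λ≈ zero    zero    = refl
  paths-cong b≈ λ≈ zero    (suc k) = refl
  paths-cong b≈ λ≈ (suc n) k       =
    +-cong (+-cong (fromBelow-cong (paths-cong b≈ λ≈ n) k) (*-cong (b≈ k) (paths-cong b≈ λ≈ n k)))
           (*-cong (λ≈ (suc k)) (paths-cong b≈ λ≈ n (suc k)))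

  paths-length-zero : ∀ b λ′ b′ λ″ k → paths b λ′ 0 k ≡ paths b′ λ″ 0 k
  paths-length-zero b λ′ b′ λ″ zero    = ≡.refl
  paths-length-zero b λ′ b′ λ″ (suc k) = ≡.refl

  shift : (ℕ → Carrier) → ℕ → Carrier
  shift s j = s (suc j)

  module _ (b λ′ : ℕ → Carrier) where
    private
      P  = paths b λ′
      P⁺ = paths (shift b) (shift λ′)

    mutual
      -- Cut a path ending above height 0 at its last visit r to height 0:
      -- what follows is an up step and a path that stays at height ≥ 1.
      paths-lastVisit : ∀ n k → P (suc n) (suc k) ≈ ∑ n (λ r → P r 0 * P⁺ (n ∸ r) k)
      paths-lastVisit zero k = begin
        P 0 k + b (suc k) * 0# + λ′ (suc (suc k)) * 0#
          ≈⟨ trans (+-cong (trans (+-congˡ (zeroʳ _)) (+-identityʳ _)) (zeroʳ _)) (+-identityʳ _) ⟩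
        P 0 k      ≡⟨ paths-length-zero b λ′ (shift b) (shift λ′) k ⟩
        P⁺ 0 k     ≈⟨ *-identityˡ _ ⟨
        1# * P⁺ 0 k ∎
      paths-lastVisit (suc n) k = begin
        P (suc n) k + β * P (suc n) (suc k) + μ * P (suc n) (suc (suc k))
          ≈⟨ +-cong (+-cong (lastVisit-below n k) (*-congˡ (paths-lastVisit n k)))
                    (*-congˡ (paths-lastVisit n (suc k))) ⟩
        (∑ n F + X) + β * ∑ n G + μ * ∑ n H
          ≈⟨ solve 4 (λ f x g h → f :+ x :+ g :+ h := f :+ g :+ h :+ x) refl
                     (∑ n F) X (β * ∑ n G) (μ * ∑ n H) ⟩
        (∑ n F + β * ∑ n G + μ * ∑ n H) + X
          ≈⟨ +-congʳ collect ⟨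
        ∑ n (λ r → P r 0 * P⁺ (suc (n ∸ r)) k) + X
          ≈⟨ +-cong (∑-cong-≤ n (λ r r≤n → *-congˡ (reflexive
                      (≡.cong (λ m → P⁺ m k) (≡.sym (ℕₚ.+-∸-assoc 1 r≤n))))))
                    (*-congˡ (reflexive (≡.cong (λ m → P⁺ m k) (≡.sym (ℕₚ.n∸n≡0 n))))) ⟩
        ∑ (suc n) (λ r → P r 0 * P⁺ (suc n ∸ r) k) ∎
        where
        β = b (suc k)
        μ = λ′ (suc (suc k))
        X = P (suc n) 0 * P⁺ 0 k
        F G H : ℕ → Carrier
        F r = P r 0 * fromBelow (P⁺ (n ∸ r)) k
        G r = P r 0 * P⁺ (n ∸ r) k
        H r = P r 0 * P⁺ (n ∸ r) (suc k)
        collect : ∑ n (λ r → P r 0 * P⁺ (suc (n ∸ r)) k) ≈ ∑ n F + β * ∑ n G + μ * ∑ n H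
        collect = begin
          ∑ n (λ r → P r 0 * P⁺ (suc (n ∸ r)) k)
            ≈⟨ ∑-cong n (λ r → solve 6 (λ p f g h x y → p :* (f :+ x :* g :+ y :* h)
                                                  := p :* f :+ x :* (p :* g) :+ y :* (p :* h))
                  refl (P r 0) (fromBelow (P⁺ (n ∸ r)) k) (P⁺ (n ∸ r) k) (P⁺ (n ∸ r) (suc k)) β μ) ⟩
          ∑ n (λ r → F r + β * G r + μ * H r)
            ≈⟨ trans (∑-distrib-+ n _ _) (+-congʳ (∑-distrib-+ n _ _)) ⟩
          ∑ n F + ∑ n (λ r → β * G r) + ∑ n (λ r → μ * H r)
            ≈⟨ +-cong (+-congˡ (∑-distribˡ n β G)) (∑-distribˡ n μ H) ⟨
          ∑ n F + β * ∑ n G + μ * ∑ n H ∎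

      lastVisit-below : ∀ n k →
        P (suc n) k ≈ ∑ n (λ r → P r 0 * fromBelow (P⁺ (n ∸ r)) k) + P (suc n) 0 * P⁺ 0 k
      lastVisit-below n zero =
        sym (trans (+-cong (∑-zero n (λ r _ → zeroʳ _)) (*-identityʳ _)) (+-identityˡ _))
      lastVisit-below n (suc k) =
        trans (paths-lastVisit n k) (sym (trans (+-congˡ (zeroʳ _)) (+-identityʳ _)))

    returnWeight : ℕ → Carrier
    returnWeight zero    = b 0
    returnWeight (suc r) = λ′ 1 * P⁺ r 0

    -- A path from 0 to 0 starts either with a level step or with an up step
    -- followed by a first return to height 0; returnWeight r weighs such a
    -- first piece of length r + 1.
    paths-firstReturn : ∀ m → P (suc m) 0 ≈ ∑ m (λ r → returnWeight r * P (m ∸ r) 0)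
    paths-firstReturn zero =
      trans (+-congˡ (zeroʳ _)) (trans (+-identityʳ _) (+-identityˡ _))
    paths-firstReturn (suc m) = begin
      0# + b 0 * P (suc m) 0 + λ′ 1 * P (suc m) 1
        ≈⟨ +-cong (+-identityˡ _) (*-congˡ (paths-lastVisit m 0)) ⟩
      b 0 * P (suc m) 0 + λ′ 1 * ∑ m (λ r → P r 0 * P⁺ (m ∸ r) 0)
        ≈⟨ +-congˡ (*-congˡ (∑-convolution-comm m _ _)) ⟩
      b 0 * P (suc m) 0 + λ′ 1 * ∑ m (λ r → P⁺ r 0 * P (m ∸ r) 0)
        ≈⟨ +-congˡ (trans (∑-distribˡ m _ _) (∑-cong m (λ r → sym (*-assoc _ _ _)))) ⟩
      b 0 * P (suc m) 0 + ∑ m (λ r → (λ′ 1 * P⁺ r 0) * P (m ∸ r) 0)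
        ≈⟨ ∑-front m _ ⟨
      ∑ (suc m) (λ r → returnWeight r * P (suc m ∸ r) 0) ∎

  truncate : ℕ → (ℕ → Carrier) → ℕ → Carrier
  truncate c s j = if j ≤ᵇ c then s j else 0#

  truncate-≤ : ∀ {c} s {j} → j ≤ c → truncate c s j ≈ s j
  truncate-≤ {c} s {j} j≤c with j ≤ᵇ c | ℕₚ.≤⇒≤ᵇ j≤c
  ... | true | _ = refl

  shift-truncate : ∀ c s j → shift (truncate (suc c) s) j ≡ truncate c (shift s) j
  shift-truncate c s zero    = ≡.refl
  shift-truncate c s (suc j) = ≡.refl

  -- A path of length n ending at height k never climbs above n + k.
  paths-truncate : ∀ b λ′ c n k → n ℕ.+ k ≤ c → paths b (truncate c λ′) n k ≈ paths b λ′ n k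
  paths-truncate b λ′ c zero    k _ = reflexive (paths-length-zero b _ b _ k)
  paths-truncate b λ′ c (suc n) k n+k<c =
    +-cong (+-cong (fromBelow-truncate k n+k≤c) (*-congˡ (paths-truncate b λ′ c n k n+k≤c)))
           (*-cong (truncate-≤ λ′ (ℕₚ.≤-trans (ℕₚ.m≤n+m (suc k) n) n+1+k≤c))
                   (paths-truncate b λ′ c n (suc k) n+1+k≤c))
    where
    n+k≤c : n ℕ.+ k ≤ c
    n+k≤c = ℕₚ.≤-trans (ℕₚ.n≤1+n _) n+k<c
    n+1+k≤c : n ℕ.+ suc k ≤ c
    n+1+k≤c = ≡.subst (_≤ c) (≡.sym (ℕₚ.+-suc n k)) n+k<c
    fromBelow-truncate : ∀ k → n ℕ.+ k ≤ c →
      fromBelow (paths b (truncate c λ′) n) k ≈ fromBelow (paths b λ′ n) k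
    fromBelow-truncate zero    _     = refl
    fromBelow-truncate (suc k) n+k≤c =
      paths-truncate b λ′ c n k (ℕₚ.≤-trans (ℕₚ.+-monoʳ-≤ n (ℕₚ.n≤1+n k)) n+k≤c)

ℕ-semiring : CommutativeSemiring _ _
ℕ-semiring = ℕₚ.+-*-commutativeSemiring

ℕ[t] : CommutativeSemiring _ _
ℕ[t] = CauchyProduct.cauchySemiring ℕ-semiring

-- Coefficient arrays p i j of Poly, read as polynomials in a over ℕ[t].
ℕ[t][a] : CommutativeSemiring _ _
ℕ[t][a] = CauchyProduct.cauchySemiring ℕ[t]

private
  module ∑₀ = FiniteSum ℕ-semiring
  module ∑₁ = FiniteSum ℕ[t]
  module C₀ = CauchyProduct ℕ-semiring
  module C₁ = CauchyProduct ℕ[t]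

module _ where
  open ≡.≡-Reasoning

  sumTo≡∑ : ∀ n f → sumTo n f ≡ ∑₀.∑ n f
  sumTo≡∑ zero    f = ≡.refl
  sumTo≡∑ (suc n) f = ≡.cong (ℕ._+ f (suc n)) (sumTo≡∑ n f)

  ∑₁-apply : ∀ n (F : ℕ → ℕ → ℕ) j → ∑₁.∑ n F j ≡ ∑₀.∑ n (λ k → F k j)
  ∑₁-apply zero    F j = ≡.refl
  ∑₁-apply (suc n) F j = ≡.cong (ℕ._+ F (suc n) j) (∑₁-apply n F j)

  *ₚ-coefficient : ∀ p q i j → (p *ₚ q) i j ≡ ∑₀.∑ i (λ k → (p k C₀.⊛ q (i ∸ k)) j)
  *ₚ-coefficient p q i j =
    ≡.trans (sumTo≡∑ i _) (∑₀.∑-cong i (λ k → sumTo≡∑ j (λ l → p k l ℕ.* q (i ∸ k) (j ∸ l))))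

  *ₚ≡⊛ : ∀ p q i j → (p *ₚ q) i j ≡ (p C₁.⊛ q) i j
  *ₚ≡⊛ p q i j = ≡.trans (*ₚ-coefficient p q i j) (≡.sym (∑₁-apply i _ j))

  1ₚ≡𝟙 : ∀ i j → 1ₚ i j ≡ C₁.𝟙 i j
  1ₚ≡𝟙 zero    zero    = ≡.refl
  1ₚ≡𝟙 zero    (suc j) = ≡.refl
  1ₚ≡𝟙 (suc i) j       = ≡.refl

  D : (ℕ → ℕ) → ℕ → ℕ
  D f j = suc j ℕ.* f (suc j)

  D-⊛ : ∀ f g j → D (f C₀.⊛ g) j ≡ (D f C₀.⊛ g) j ℕ.+ (f C₀.⊛ D g) j
  D-⊛ f g j = begin
    suc j ℕ.* ∑₀.∑ (suc j) X
      ≡⟨ ∑₀.∑-distribˡ (suc j) (suc j) X ⟩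
    ∑₀.∑ (suc j) (λ l → suc j ℕ.* X l)
      ≡⟨ ∑₀.∑-cong-≤ (suc j) (λ l l≤ → ≡.trans (≡.cong (ℕ._* X l) (≡.sym (ℕₚ.m+[n∸m]≡n l≤)))
                                                 (ℕₚ.*-distribʳ-+ (X l) l (suc j ∸ l))) ⟩
    ∑₀.∑ (suc j) (λ l → l ℕ.* X l ℕ.+ (suc j ∸ l) ℕ.* X l)
      ≡⟨ ∑₀.∑-distrib-+ (suc j) _ _ ⟩
    ∑₀.∑ (suc j) (λ l → l ℕ.* X l) ℕ.+ ∑₀.∑ (suc j) (λ l → (suc j ∸ l) ℕ.* X l)
      ≡⟨ ≡.cong₂ ℕ._+_ differentiate-f differentiate-g ⟩
    (D f C₀.⊛ g) j ℕ.+ (f C₀.⊛ D g) j ∎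
    where
    X : ℕ → ℕ
    X l = f l ℕ.* g (suc j ∸ l)
    -- the l = 0 term vanishes
    differentiate-f : ∑₀.∑ (suc j) (λ l → l ℕ.* X l) ≡ (D f C₀.⊛ g) j
    differentiate-f = ≡.trans (∑₀.∑-front j (λ l → l ℕ.* X l))
      (∑₀.∑-cong j (λ l → ≡.sym (ℕₚ.*-assoc (suc l) (f (suc l)) (g (j ∸ l)))))
    -- the l = j + 1 term vanishes
    differentiate-g : ∑₀.∑ (suc j) (λ l → (suc j ∸ l) ℕ.* X l) ≡ (f C₀.⊛ D g) j
    differentiate-g = begin
      ∑₀.∑ j (λ l → (suc j ∸ l) ℕ.* X l) ℕ.+ (j ∸ j) ℕ.* X (suc j)
        ≡⟨ ≡.cong (λ m → ∑₀.∑ j (λ l → (suc j ∸ l) ℕ.* X l) ℕ.+ m ℕ.* X (suc j)) (ℕₚ.n∸n≡0 j) ⟩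
      ∑₀.∑ j (λ l → (suc j ∸ l) ℕ.* X l) ℕ.+ 0
        ≡⟨ ℕₚ.+-identityʳ _ ⟩
      ∑₀.∑ j (λ l → (suc j ∸ l) ℕ.* X l)
        ≡⟨ ∑₀.∑-cong-≤ j weight ⟩
      (f C₀.⊛ D g) j ∎
      where
      weight : ∀ l → l ≤ j → (suc j ∸ l) ℕ.* X l ≡ f l ℕ.* (suc (j ∸ l) ℕ.* g (suc (j ∸ l)))
      weight l l≤j rewrite ℕₚ.+-∸-assoc 1 l≤j =
        ≡.trans (≡.sym (ℕₚ.*-assoc (suc (j ∸ l)) (f l) _))
          (≡.trans (≡.cong (ℕ._* g (suc (j ∸ l))) (ℕₚ.*-comm (suc (j ∸ l)) (f l))) (ℕₚ.*-assoc (f l) _ _))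

  ∂ₜ-*ₚ : ∀ p q i j → ∂ₜ (p *ₚ q) i j ≡ (∂ₜ p *ₚ q +ₚ p *ₚ ∂ₜ q) i j
  ∂ₜ-*ₚ p q i j = begin
    suc j ℕ.* (p *ₚ q) i (suc j)
      ≡⟨ ≡.cong (suc j ℕ.*_) (*ₚ-coefficient p q i (suc j)) ⟩
    suc j ℕ.* ∑₀.∑ i (λ k → (p k C₀.⊛ q (i ∸ k)) (suc j))
      ≡⟨ ∑₀.∑-distribˡ i (suc j) _ ⟩
    ∑₀.∑ i (λ k → D (p k C₀.⊛ q (i ∸ k)) j)
      ≡⟨ ∑₀.∑-cong i (λ k → D-⊛ (p k) (q (i ∸ k)) j) ⟩
    ∑₀.∑ i (λ k → (D (p k) C₀.⊛ q (i ∸ k)) j ℕ.+ (p k C₀.⊛ D (q (i ∸ k))) j)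
      ≡⟨ ∑₀.∑-distrib-+ i _ _ ⟩
    ∑₀.∑ i (λ k → (D (p k) C₀.⊛ q (i ∸ k)) j) ℕ.+ ∑₀.∑ i (λ k → (p k C₀.⊛ D (q (i ∸ k))) j)
      ≡⟨ ≡.cong₂ ℕ._+_ (*ₚ-coefficient (∂ₜ p) q i j) (*ₚ-coefficient p (∂ₜ q) i j) ⟨
    (∂ₜ p *ₚ q +ₚ p *ₚ ∂ₜ q) i j ∎

-- Opaque copies of the operations on Poly: unification must never unfold a
-- coefficient convolution, or implicit arguments of the semiring laws stop
-- being inferable.
opaque
  infixl 6 _⊕_
  infixl 7 _⊗_

  _⊕_ : Poly → Poly → Poly
  _⊕_ = _+ₚ_

  _⊗_ : Poly → Poly → Poly
  _⊗_ = _*ₚ_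

  ∂ : Poly → Poly
  ∂ = ∂ₜ

opaque
  unfolding _⊕_ _⊗_

  ⊗-agrees : ∀ p q → CommutativeSemiring._≈_ ℕ[t][a] (p ⊗ q) (CommutativeSemiring._*_ ℕ[t][a] p q)
  ⊗-agrees = *ₚ≡⊛

  ⊕-agrees : ∀ p q → CommutativeSemiring._≈_ ℕ[t][a] (p ⊕ q) (CommutativeSemiring._+_ ℕ[t][a] p q)
  ⊕-agrees p q i j = ≡.refl

ℕ[a,t] : CommutativeSemiring _ _
ℕ[a,t] = replaceOperations ℕ[t][a] _⊕_ _⊗_ 0ₚ 1ₚ ⊕-agrees ⊗-agrees (λ i j → ≡.refl) 1ₚ≡𝟙

open CommutativeSemiring ℕ[a,t] hiding (zero)
open FiniteSum ℕ[a,t]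
open MotzkinPaths ℕ[a,t]
open SetoidReasoning setoid
open import Algebra.Solver.Ring.NaturalCoefficients.Default ℕ[a,t]

B : ℕ → Poly
B k = (constₚ (2 ℕ.* k) + aₚ) * tₚ

μ : ℕ → Poly
μ k = constₚ k * (constₚ (k ∸ 1) + aₚ)

opaque
  unfolding _⊕_ _⊗_ ∂

  *ₚ≈* : ∀ p q → p *ₚ q ≈ p * q
  *ₚ≈* p q i j = ≡.refl

  sumPoly≈∑ : ∀ n f → sumPoly n f ≈ ∑ n f
  sumPoly≈∑ zero    f i j = ≡.refl
  sumPoly≈∑ (suc n) f i j = ≡.cong (ℕ._+ f (suc n) i j) (sumPoly≈∑ n f i j)

  *ₛ≈∑ : ∀ F G n → (F *ₛ G) n ≈ ∑ n (λ k → F k * G (n ∸ k))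
  *ₛ≈∑ F G n = sumPoly≈∑ n (λ k → F k *ₚ G (n ∸ k))

  ∂-cong : ∀ {p q} → p ≈ q → ∂ p ≈ ∂ q
  ∂-cong p≈q i j = ≡.cong (suc j ℕ.*_) (p≈q i (suc j))

  ∂-+ : ∀ p q → ∂ (p + q) ≈ ∂ p + ∂ q
  ∂-+ p q i j = ℕₚ.*-distribˡ-+ (suc j) (p i (suc j)) (q i (suc j))

  ∂-* : ∀ p q → ∂ (p * q) ≈ ∂ p * q + p * ∂ q
  ∂-* = ∂ₜ-*ₚ

  ∂-const : ∀ m → ∂ (constₚ m) ≈ 0#
  ∂-const m zero    j = ℕₚ.*-zeroʳ (suc j)
  ∂-const m (suc i) j = ℕₚ.*-zeroʳ (suc j)

  ∂-a : ∂ aₚ ≈ 0#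
  ∂-a zero          j = ℕₚ.*-zeroʳ (suc j)
  ∂-a (suc zero)    j = ℕₚ.*-zeroʳ (suc j)
  ∂-a (suc (suc i)) j = ℕₚ.*-zeroʳ (suc j)

  ∂-t : ∂ tₚ ≈ 1#
  ∂-t zero    zero    = ≡.refl
  ∂-t zero    (suc j) = ℕₚ.*-zeroʳ (suc (suc j))
  ∂-t (suc i) j       = ℕₚ.*-zeroʳ (suc j)

  const-+ : ∀ m n → constₚ (m ℕ.+ n) ≈ constₚ m + constₚ n
  const-+ m n zero    zero    = ≡.refl
  const-+ m n zero    (suc j) = ≡.refl
  const-+ m n (suc i) j       = ≡.refl

  const-0 : constₚ 0 ≈ 0#
  const-0 zero    zero    = ≡.refl
  const-0 zero    (suc j) = ≡.refl
  const-0 (suc i) j       = ≡.refl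

  const-1 : constₚ 1 ≈ 1#
  const-1 zero    zero    = ≡.refl
  const-1 zero    (suc j) = ≡.refl
  const-1 (suc i) j       = ≡.refl

  1+t²-def : 1+t² ≈ 1# + tₚ * tₚ
  1+t²-def i j = ≡.refl

  Q-suc : ∀ n → Q (suc n) ≈ 1+t² * ∂ (Q n) + aₚ * tₚ * Q n
  Q-suc n i j = ≡.refl

  bQ-def : ∀ k → bQ k ≈ B k
  bQ-def k i j = ≡.refl

  λQ-def : ∀ k → λQ k ≈ μ k * 1+t²
  λQ-def k i j = ≡.refl

module _ (U : Series) where
  private
    power : ℕ → Series
    power k = (z* U) ^ₛ k

  z*-convolution-zero : ∀ G → ((z* U) *ₛ G) 0 ≈ 0#
  z*-convolution-zero G = trans (*ₛ≈∑ (z* U) G 0) (zeroˡ _)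

  z*-convolution-suc : ∀ G n → ((z* U) *ₛ G) (suc n) ≈ ∑ n (λ m → U m * G (n ∸ m))
  z*-convolution-suc G n =
    trans (*ₛ≈∑ (z* U) G (suc n)) (trans (∑-front n _) (trans (+-congʳ (zeroˡ _)) (+-identityˡ _)))

  z*-power-vanishes : ∀ k m → m < k → power k m ≈ 0#
  z*-power-vanishes (suc k) zero    _         = z*-convolution-zero (power k)
  z*-power-vanishes (suc k) (suc m) (s≤s m<k) =
    trans (z*-convolution-suc (power k) m) (∑-zero m (λ r _ →
      trans (*-congˡ (z*-power-vanishes k (m ∸ r) (ℕₚ.≤-trans (s≤s (ℕₚ.m∸n≤m m r)) m<k))) (zeroʳ _)))

  inv1-z*-suc : ∀ n → inv1-z* U (suc n) ≈ ∑ n (λ m → U m * inv1-z* U (n ∸ m))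
  inv1-z*-suc n = begin
    inv1-z* U (suc n)                                 ≈⟨ sumPoly≈∑ (suc n) (λ k → power k (suc n)) ⟩
    ∑ (suc n) (λ k → power k (suc n))                 ≈⟨ ∑-front n _ ⟩
    0# + ∑ n (λ k → power (suc k) (suc n))            ≈⟨ +-identityˡ _ ⟩
    ∑ n (λ k → power (suc k) (suc n))                 ≈⟨ ∑-cong n (λ k → z*-convolution-suc (power k) n) ⟩
    ∑ n (λ k → ∑ n (λ m → U m * power k (n ∸ m)))     ≈⟨ ∑-swap n n _ ⟩
    ∑ n (λ m → ∑ n (λ k → U m * power k (n ∸ m)))     ≈⟨ ∑-cong n (λ m → ∑-distribˡ n (U m) _) ⟨
    ∑ n (λ m → U m * ∑ n (λ k → power k (n ∸ m)))     ≈⟨ ∑-cong n (λ m → *-congˡ (truncated m)) ⟩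
    ∑ n (λ m → U m * inv1-z* U (n ∸ m))               ∎
    where
    truncated : ∀ m → ∑ n (λ k → power k (n ∸ m)) ≈ inv1-z* U (n ∸ m)
    truncated m = trans (∑-extend _ (ℕₚ.m∸n≤m n m) (λ k → z*-power-vanishes k (n ∸ m)))
                        (sym (sumPoly≈∑ (n ∸ m) (λ k → power k (n ∸ m))))

  inv1-z*-unique : ∀ (F : Series) → F 0 ≈ 1# → (∀ m → F (suc m) ≈ ∑ m (λ r → U r * F (m ∸ r))) →
                   ∀ n → inv1-z* U n ≈ F n
  inv1-z*-unique F F₀ F-suc = <-rec (λ n → inv1-z* U n ≈ F n) step
    where
    step : ∀ n → (∀ {m} → m < n → inv1-z* U m ≈ F m) → inv1-z* U n ≈ F n
    step zero    _  = sym F₀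
    step (suc n) ih = trans (inv1-z*-suc n)
      (trans (∑-cong-≤ n (λ r _ → *-congˡ (ih (s≤s (ℕₚ.m∸n≤m n r))))) (sym (F-suc n)))

shiftBy : ℕ → (ℕ → Poly) → ℕ → Poly
shiftBy h s j = s (j ℕ.+ h)

fracTail : (b λ′ : ℕ → Poly) → ℕ → ℕ → Series
fracTail b λ′ zero    h m = 0ₚ
fracTail b λ′ (suc d) h m = λ′ (suc h) *ₚ frac b λ′ d (suc h) m

-- frac b λ′ d h is 1/(1 − zU) for a series U that is local to the definition
-- of frac; this record gives it a name.
record FracDenominator (b λ′ : ℕ → Poly) (d h : ℕ) : Set where
  field
    U            : Series
    frac≡inv1-z* : ∀ n → frac b λ′ d h n ≡ inv1-z* U n
    U-zero       : U 0 ≡ b h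
    U-suc        : ∀ m → U (suc m) ≡ fracTail b λ′ d h m

fracDenominator : ∀ b λ′ d h → FracDenominator b λ′ d h
fracDenominator b λ′ zero h =
  record { U = _ ; frac≡inv1-z* = λ n → ≡.refl ; U-zero = ≡.refl ; U-suc = λ m → ≡.refl }
fracDenominator b λ′ (suc d) h =
  record { U = _ ; frac≡inv1-z* = λ n → ≡.refl ; U-zero = ≡.refl ; U-suc = λ m → ≡.refl }

mutual
  frac-paths : ∀ b λ′ d h n → frac b λ′ d h n ≈ paths (shiftBy h b) (truncate d (shiftBy h λ′)) n 0
  frac-paths b λ′ d h n = begin
    frac b λ′ d h n       ≡⟨ frac≡inv1-z* n ⟩
    inv1-z* U n           ≈⟨ inv1-z*-unique U (λ m → paths β λ″ m 0) refl firstReturn n ⟩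
    paths β λ″ n 0        ∎
    where
    open FracDenominator (fracDenominator b λ′ d h)
    β  = shiftBy h b
    λ″ = truncate d (shiftBy h λ′)
    U≈returnWeight : ∀ r → U r ≈ returnWeight β λ″ r
    U≈returnWeight zero    = reflexive U-zero
    U≈returnWeight (suc r) = trans (reflexive (U-suc r)) (fracTail≈returnWeight b λ′ d h r)
    firstReturn : ∀ m → paths β λ″ (suc m) 0 ≈ ∑ m (λ r → U r * paths β λ″ (m ∸ r) 0)
    firstReturn m =
      trans (paths-firstReturn β λ″ m) (∑-cong m (λ r → *-congʳ (sym (U≈returnWeight r))))

  fracTail≈returnWeight : ∀ b λ′ d h r →
    fracTail b λ′ d h r ≈ returnWeight (shiftBy h b) (truncate d (shiftBy h λ′)) (suc r)
  fracTail≈returnWeight b λ′ zero    h r = sym (zeroˡ _)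
  fracTail≈returnWeight b λ′ (suc d) h r = begin
    λ′ (suc h) *ₚ frac b λ′ d (suc h) r
      ≈⟨ *ₚ≈* _ _ ⟩
    λ′ (suc h) * frac b λ′ d (suc h) r
      ≈⟨ *-congˡ (frac-paths b λ′ d (suc h) r) ⟩
    λ′ (suc h) * paths (shiftBy (suc h) b) (truncate d (shiftBy (suc h) λ′)) r 0
      ≈⟨ *-congˡ (paths-cong (λ j → reflexive (≡.cong b (ℕₚ.+-suc j h))) (λ j → reflexive (shifted j)) r 0) ⟩
    λ′ (suc h) * paths (shift (shiftBy h b)) (shift (truncate (suc d) (shiftBy h λ′))) r 0 ∎
    where
    shifted : ∀ j → truncate d (shiftBy (suc h) λ′) j ≡ shift (truncate (suc d) (shiftBy h λ′)) j
    shifted j = ≡.trans (≡.cong (λ x → if j ≤ᵇ d then x else 0#) (≡.cong λ′ (ℕₚ.+-suc j h)))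
                        (≡.sym (shift-truncate d (shiftBy h λ′) j))

const-suc : ∀ m → constₚ (suc m) ≈ 1# + constₚ m
const-suc m = trans (const-+ 1 m) (+-congʳ const-1)

const-double : ∀ m → constₚ (2 ℕ.* m) ≈ constₚ m + constₚ m
const-double m = trans (const-+ m (m ℕ.+ 0)) (+-congˡ (reflexive (≡.cong constₚ (ℕₚ.+-identityʳ m))))

B-zero : B 0 ≈ aₚ * tₚ
B-zero = *-congʳ (trans (+-congʳ const-0) (+-identityˡ _))

B-suc : ∀ k → B k + (tₚ + tₚ) ≈ B (suc k)
B-suc k = begin
  (C + aₚ) * tₚ + (tₚ + tₚ)              ≈⟨ solve 3 (λ c a t → (c :+ a) :* t :+ (t :+ t)
                                                      := ((con 1 :+ con 1) :+ c :+ a) :* t) refl C aₚ tₚ ⟩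
  ((1# + 1#) + C + aₚ) * tₚ              ≈⟨ *-congʳ (+-congʳ two+C) ⟨
  (constₚ (2 ℕ.* suc k) + aₚ) * tₚ       ∎
  where
  C = constₚ (2 ℕ.* k)
  two+C : constₚ (2 ℕ.* suc k) ≈ (1# + 1#) + C
  two+C = trans (reflexive (≡.cong constₚ (ℕₚ.*-suc 2 k)))
                (trans (const-+ 2 (2 ℕ.* k)) (+-congʳ (trans (const-suc 1) (+-congˡ const-1))))

μ-zero : μ 0 ≈ 0#
μ-zero = trans (*-congʳ const-0) (zeroˡ _)

μ-suc : ∀ k → μ k + (constₚ (2 ℕ.* k) + aₚ) ≈ μ (suc k)
μ-suc zero = begin
  μ 0 + (constₚ 0 + aₚ)   ≈⟨ trans (+-congʳ μ-zero) (+-identityˡ _) ⟩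
  constₚ 0 + aₚ           ≈⟨ trans (*-congʳ const-1) (*-identityˡ _) ⟨
  μ 1                     ∎
μ-suc (suc k) = begin
  μ (suc k) + (constₚ (2 ℕ.* suc k) + aₚ)
    ≈⟨ +-cong (*-congʳ (const-suc k)) (+-congʳ (trans (const-double (suc k)) (+-cong (const-suc k) (const-suc k)))) ⟩
  (1# + K) * (K + aₚ) + (((1# + K) + (1# + K)) + aₚ)
    ≈⟨ solve 2 (λ K a → (con 1 :+ K) :* (K :+ a) :+ (((con 1 :+ K) :+ (con 1 :+ K)) :+ a)
                     := (con 1 :+ (con 1 :+ K)) :* ((con 1 :+ K) :+ a)) refl K aₚ ⟩
  (1# + (1# + K)) * ((1# + K) + aₚ)
    ≈⟨ *-cong (trans (const-suc (suc k)) (+-congˡ (const-suc k))) (+-congʳ (const-suc k)) ⟨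
  μ (suc (suc k)) ∎
  where
  K = constₚ k

∂-0 : ∂ 0# ≈ 0#
∂-0 = trans (∂-cong (sym const-0)) (∂-const 0)

∂-1 : ∂ 1# ≈ 0#
∂-1 = trans (∂-cong (sym const-1)) (∂-const 1)

∂-scalar : ∀ {p} q → ∂ p ≈ 0# → ∂ (p * q) ≈ p * ∂ q
∂-scalar q ∂p≈0 = trans (∂-* _ q) (trans (+-congʳ (trans (*-congʳ ∂p≈0) (zeroˡ _))) (+-identityˡ _))

∂-const+a : ∀ m → ∂ (constₚ m + aₚ) ≈ 0#
∂-const+a m = trans (∂-+ _ _) (trans (+-cong (∂-const m) ∂-a) (+-identityˡ _))

∂-μ : ∀ k → ∂ (μ k) ≈ 0#
∂-μ k = trans (∂-scalar _ (∂-const k)) (trans (*-congˡ (∂-const+a _)) (zeroʳ _))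

∂-B : ∀ k → ∂ (B k) ≈ constₚ (2 ℕ.* k) + aₚ
∂-B k = trans (∂-scalar tₚ (∂-const+a _)) (trans (*-congˡ ∂-t) (*-identityʳ _))

∂-1+t² : ∂ 1+t² ≈ tₚ + tₚ
∂-1+t² = begin
  ∂ 1+t²                     ≈⟨ trans (∂-cong 1+t²-def) (∂-+ _ _) ⟩
  ∂ 1# + ∂ (tₚ * tₚ)         ≈⟨ +-cong ∂-1 (∂-* tₚ tₚ) ⟩
  0# + (∂ tₚ * tₚ + tₚ * ∂ tₚ) ≈⟨ trans (+-identityˡ _) (+-cong (*-congʳ ∂-t) (*-congˡ ∂-t)) ⟩
  1# * tₚ + tₚ * 1#          ≈⟨ +-cong (*-identityˡ _) (*-identityʳ _) ⟩
  tₚ + tₚ                    ∎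

-- T n k = ∂ᵏ(Q n) / (k! (a)_k), defined through the recurrence for T_{n+1,k}
-- of the header so that no division occurs.
T : ℕ → ℕ → Poly
T n       zero    = Q n
T zero    (suc k) = 0#
T (suc n) (suc k) = T n k + B (suc k) * T n (suc k) + 1+t² * ∂ (T n (suc k))

T-suc : ∀ n k → T (suc n) k ≈ fromBelow (T n) k + B k * T n k + 1+t² * ∂ (T n k)
T-suc n zero = begin
  Q (suc n)                               ≈⟨ trans (Q-suc n) (+-comm _ _) ⟩
  aₚ * tₚ * Q n + 1+t² * ∂ (Q n)          ≈⟨ +-congʳ (trans (+-identityˡ _) (*-congʳ B-zero)) ⟨
  0# + B 0 * Q n + 1+t² * ∂ (Q n)         ∎
T-suc n (suc k) = refl

∂-T-step : ∀ n k → ∂ (fromBelow (T n) k) ≈ μ k * T n k → ∂ (T n k) ≈ μ (suc k) * T n (suc k) →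
           ∂ (T (suc n) k) ≈ μ (suc k) * T (suc n) (suc k)
∂-T-step n k ∂T↓ ∂T = begin
  ∂ (T (suc n) k)
    ≈⟨ ∂-cong (T-suc n k) ⟩
  ∂ (fromBelow (T n) k + B k * Y + 1+t² * ∂ Y)
    ≈⟨ trans (∂-+ _ _) (+-cong (trans (∂-+ _ _) (+-cong ∂T↓ (∂-* _ _))) (∂-* _ _)) ⟩
  μ k * Y + (∂ (B k) * Y + B k * ∂ Y) + (∂ 1+t² * ∂ Y + 1+t² * ∂ (∂ Y))
    ≈⟨ +-cong (+-congˡ (+-cong (*-congʳ (∂-B k)) (*-congˡ ∂T)))
              (+-cong (*-cong ∂-1+t² ∂T) (*-congˡ ∂∂T)) ⟩
  μ k * Y + (c * Y + B k * (μ′ * Z)) + ((tₚ + tₚ) * (μ′ * Z) + 1+t² * (μ′ * ∂ Z))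
    ≈⟨ solve 9 (λ m c m′ b t u y z dz →
                  m :* y :+ (c :* y :+ b :* (m′ :* z)) :+ ((t :+ t) :* (m′ :* z) :+ u :* (m′ :* dz))
               := (m :+ c) :* y :+ m′ :* ((b :+ (t :+ t)) :* z :+ u :* dz))
               refl (μ k) c μ′ (B k) tₚ 1+t² Y Z (∂ Z) ⟩
  (μ k + c) * Y + μ′ * ((B k + (tₚ + tₚ)) * Z + 1+t² * ∂ Z)
    ≈⟨ +-cong (*-congʳ (μ-suc k)) (*-congˡ (+-congʳ (*-congʳ (B-suc k)))) ⟩
  μ′ * Y + μ′ * (B (suc k) * Z + 1+t² * ∂ Z)
    ≈⟨ trans (*-congˡ (+-assoc _ _ _)) (distribˡ _ _ _) ⟨
  μ′ * T (suc n) (suc k) ∎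
  where
  Y  = T n k
  Z  = T n (suc k)
  μ′ = μ (suc k)
  c  = constₚ (2 ℕ.* k) + aₚ
  ∂∂T : ∂ (∂ Y) ≈ μ′ * ∂ Z
  ∂∂T = trans (∂-cong ∂T) (∂-scalar Z (∂-μ (suc k)))

mutual
  ∂-T : ∀ n k → ∂ (T n k) ≈ μ (suc k) * T n (suc k)
  ∂-T zero    zero    = trans ∂-1 (sym (zeroʳ _))
  ∂-T zero    (suc k) = trans ∂-0 (sym (zeroʳ _))
  ∂-T (suc n) k       = ∂-T-step n k (∂-fromBelow-T n k) (∂-T n k)

  ∂-fromBelow-T : ∀ n k → ∂ (fromBelow (T n) k) ≈ μ k * T n k
  ∂-fromBelow-T n zero    = trans ∂-0 (sym (trans (*-congʳ μ-zero) (zeroˡ _)))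
  ∂-fromBelow-T n (suc k) = ∂-T n k

paths-T : ∀ n k → paths bQ λQ n k ≈ T n k
paths-T zero    zero    = refl
paths-T zero    (suc k) = refl
paths-T (suc n) k       = begin
  fromBelow (P n) k + bQ k * P n k + λQ (suc k) * P n (suc k)
    ≈⟨ +-cong (+-cong (fromBelow-cong (paths-T n) k) (*-cong (bQ-def k) (paths-T n k))) downStep ⟩
  fromBelow (T n) k + B k * T n k + 1+t² * ∂ (T n k)
    ≈⟨ T-suc n k ⟨
  T (suc n) k ∎
  where
  P = paths bQ λQ
  downStep : λQ (suc k) * P n (suc k) ≈ 1+t² * ∂ (T n k)
  downStep = begin
    λQ (suc k) * P n (suc k)          ≈⟨ *-cong (trans (λQ-def (suc k)) (*-comm _ _)) (paths-T n (suc k)) ⟩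
    1+t² * μ (suc k) * T n (suc k)    ≈⟨ *-assoc _ _ _ ⟩
    1+t² * (μ (suc k) * T n (suc k))  ≈⟨ *-congˡ (∂-T n k) ⟨
    1+t² * ∂ (T n k)                  ∎

theorem3p17 : (n N : ℕ) → n ≤ N → (i j : ℕ) →
    Jconv bQ λQ N n i j ≡ Q n i j
theorem3p17 n N n≤N = begin
  Jconv bQ λQ N n                                          ≈⟨ frac-paths bQ λQ N 0 n ⟩
  paths (shiftBy 0 bQ) (truncate N (shiftBy 0 λQ)) n 0     ≈⟨ paths-truncate _ _ N n 0 n+0≤N ⟩
  paths (shiftBy 0 bQ) (shiftBy 0 λQ) n 0                  ≈⟨ paths-cong (+0 bQ) (+0 λQ) n 0 ⟩
  paths bQ λQ n 0                                          ≈⟨ paths-T n 0 ⟩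
  Q n                                                      ∎
  where
  n+0≤N : n ℕ.+ 0 ≤ N
  n+0≤N = ℕₚ.≤-trans (ℕₚ.≤-reflexive (ℕₚ.+-identityʳ n)) n≤N
  +0 : ∀ s j → shiftBy 0 s j ≈ s j
  +0 s j = reflexive (≡.cong s (ℕₚ.+-identityʳ j))
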